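{- Let $T$ be the root graph of an instance $(G,s_1,s_2,t_1,t_2)$ with root vertices $C=\{v^*,s_1,s_2,t_1,t_2\}$, and let $F$ be a reduction of $T$. Then $T$ contains a subdivision of $K_5$ whose set of branch vertices (centers) is $C$ if and only if $F$ contains a subdivision of $K_5$ whose set of branch vertices is $C$.
   Context: Let $G$ be a graph with distinct vertices $s_1,s_2,t_1,t_2$. Let $G'$ be obtained from $G$ by adding a new vertex $v^*$ adjacent to each of $s_1,s_2,t_1,t_2$ and adding the edges $s_1s_2,s_2t_1,t_1t_2,t_2s_1$ (if not already present). Let $C=\{v^*,s_1,s_2,t_1,t_2\}$ and let $B$ be the block of $G'$ containing $C$. Starting from $B$, repeatedly choose a vertex cutset $\{x,y\}$ of size 2 of the current graph and a component $U$ of the current graph minus $\{x,y\}$ containing no vertex of $C$, delete $U$ and add the edge $xy$ if absent; when no such choice is possible the resulting graph $T$ is the root graph. If $H$ is a 3-connected graph containing the vertices of $C$ and the edges of $G'$ joining them, a reduction of $H$ is a 3-connected graph $F$ such that (i) $C\subseteq V(F)\subseteq V(H)$; (ii) for every component $U$ of $H-V(F)$, the set $S(U)$ of vertices of $F$ having a neighbour in $U$ forms a triangle of $F$; (iii) $E(F)$ consists of the edges of $H$ with both endpoints in $V(F)$ together with, for every component $U$ of $H-V(F)$, an edge between every pair of vertices of $S(U)$ not adjacent in $H$. -}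

module Defs where

open import Data.Nat using (ℕ; zero; suc)
open import Data.Fin using (Fin; zero; suc; _<_)
open import Data.Fin.Properties using (_≟_)
open import Data.Bool using (Bool; true; false; _∧_; _∨_; not)
open import Data.List using (List; []; _∷_; _++_; [_])
open import Data.List.Relation.Unary.All using (All)
open import Data.List.Relation.Unary.Unique.Propositional using (Unique)
open import Data.List.Membership.Propositional using (_∈_)
open import Data.Product using (Σ; ∃; ∃-syntax; _×_; _,_)
open import Data.Sum using (_⊎_)
open import Data.Unit using (⊤)
open import Relation.Nullary using (¬_; does)
open import Relation.Binary.PropositionalEquality using (_≡_; _≢_)
open import Function.Bundles using (_⇔_)

-- Graphs on an ambient finite vertex universe Fin m.
-- V = vertex-membership predicate, E = adjacency.

record Graph (m : ℕ) : Set where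
  constructor mkGraph
  field
    V : Fin m → Bool
    E : Fin m → Fin m → Bool
open Graph public

VSet : ℕ → Set
VSet m = Fin m → Bool

module _ {m : ℕ} where

  _∈ₛ_ : Fin m → VSet m → Set
  v ∈ₛ S = S v ≡ true

  _⊆ₛ_ : VSet m → VSet m → Set
  S ⊆ₛ S' = ∀ v → v ∈ₛ S → v ∈ₛ S'

  _==_ : Fin m → Fin m → Bool
  a == b = does (a ≟ b)

  _∖_ : VSet m → VSet m → VSet m
  (S ∖ X) v = S v ∧ not (X v)

  single : Fin m → VSet m
  single x v = v == x

  pair : Fin m → Fin m → VSet m
  pair x y v = (v == x) ∨ (v == y)

  isPair : Fin m → Fin m → Fin m → Fin m → Bool
  isPair p q a b = ((a == p) ∧ (b == q)) ∨ ((a == q) ∧ (b == p))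

  _≅_ : Graph m → Graph m → Set
  H ≅ H' = (∀ v → V H v ≡ V H' v) × (∀ a b → E H a b ≡ E H' a b)

  record IsSimple (G : Graph m) : Set where
    field
      sym    : ∀ a b → E G a b ≡ E G b a
      irrefl : ∀ a → E G a a ≡ false
      closed : ∀ a b → E G a b ≡ true → a ∈ₛ V G

  -- walks in H all of whose vertices lie in S (i.e. walks in H[S])
  data Walk (H : Graph m) (S : VSet m) : Fin m → Fin m → Set where
    here : ∀ {a} → a ∈ₛ S → Walk H S a a
    step : ∀ {a b c} → a ∈ₛ S → E H a b ≡ true → Walk H S b c → Walk H S a c

  ConnectedOn : Graph m → VSet m → Set
  ConnectedOn H S = ∀ a b → a ∈ₛ S → b ∈ₛ S → Walk H S a b

  IsComponent : Graph m → VSet m → VSet m → Set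
  IsComponent H S U =
    (U ⊆ₛ S) × (∃[ u ] u ∈ₛ U) × ConnectedOn H U ×
    (∀ a b → a ∈ₛ U → b ∈ₛ S → E H a b ≡ true → b ∈ₛ U)

  NoCutVertex : Graph m → VSet m → Set
  NoCutVertex H S = ConnectedOn H S × (∀ v → v ∈ₛ S → ConnectedOn H (S ∖ single v))

  IsBlockContaining : Graph m → VSet m → VSet m → Set
  IsBlockContaining H C S =
    (S ⊆ₛ V H) × (C ⊆ₛ S) × NoCutVertex H S ×
    (∀ S' → S ⊆ₛ S' → S' ⊆ₛ V H → NoCutVertex H S' → S' ⊆ₛ S)

  induced : Graph m → VSet m → Graph m
  induced H S = mkGraph S (λ a b → E H a b ∧ S a ∧ S b)

  IsCutset2 : Graph m → Fin m → Fin m → Set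
  IsCutset2 H x y =
    x ≢ y × x ∈ₛ V H × y ∈ₛ V H ×
    (∃[ a ] ∃[ b ] a ∈ₛ (V H ∖ pair x y) × b ∈ₛ (V H ∖ pair x y) ×
       ¬ Walk H (V H ∖ pair x y) a b)

  record StepChoice (C : VSet m) (H : Graph m) (x y : Fin m) (U : VSet m) : Set where
    field
      cut   : IsCutset2 H x y
      comp  : IsComponent H (V H ∖ pair x y) U
      avoid : ∀ v → v ∈ₛ C → U v ≡ false

  Step : VSet m → Graph m → Graph m → Set
  Step C H H' = ∃[ x ] ∃[ y ] ∃[ U ] StepChoice C H x y U ×
    (∀ v → V H' v ≡ (V H v ∧ not (U v))) ×
    (∀ a b → E H' a b ≡ ((E H a b ∧ not (U a) ∧ not (U b)) ∨ isPair x y a b))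

  data Reach (C : VSet m) : Graph m → Graph m → Set where
    done : ∀ {H H'} → H ≅ H' → Reach C H H'
    more : ∀ {H H₁ H'} → Step C H H₁ → Reach C H₁ H' → Reach C H H'

  ThreeConnected : Graph m → Set
  ThreeConnected H =
    (∃[ a ] ∃[ b ] ∃[ c ] ∃[ d ] a ∈ₛ V H × b ∈ₛ V H × c ∈ₛ V H × d ∈ₛ V H ×
       a ≢ b × a ≢ c × a ≢ d × b ≢ c × b ≢ d × c ≢ d) ×
    (∀ x y → ConnectedOn H (V H ∖ pair x y))

  Attach : Graph m → Graph m → VSet m → Fin m → Set
  Attach H F U v = v ∈ₛ V F × (∃[ u ] u ∈ₛ U × E H u v ≡ true)

  IsTriangle : Graph m → (Fin m → Set) → Set
  IsTriangle F P = ∃[ a ] ∃[ b ] ∃[ c ]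
    a ≢ b × b ≢ c × a ≢ c ×
    (∀ v → P v ⇔ (v ≡ a ⊎ v ≡ b ⊎ v ≡ c)) ×
    E F a b ≡ true × E F b c ≡ true × E F a c ≡ true

  record IsReduction (C : VSet m) (H F : Graph m) : Set where
    field
      threeConn : ThreeConnected F
      C⊆F       : C ⊆ₛ V F
      F⊆H       : V F ⊆ₛ V H
      triangle  : ∀ U → IsComponent H (V H ∖ V F) U → IsTriangle F (Attach H F U)
      edges     : ∀ a b → (E F a b ≡ true) ⇔
                    ((a ∈ₛ V F × b ∈ₛ V F × E H a b ≡ true) ⊎
                     (∃[ U ] IsComponent H (V H ∖ V F) U × Attach H F U a × Attach H F U b ×
                        a ≢ b × E H a b ≡ false))

  Chain : Graph m → List (Fin m) → Set
  Chain H [] = ⊤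
  Chain H (x ∷ []) = ⊤
  Chain H (x ∷ y ∷ r) = E H x y ≡ true × Chain H (y ∷ r)

  -- H contains a subdivision of K5 whose branch vertices are c 0,…,c 4
  -- (P i j = internal vertices of the path from c i to c j, for i < j)
  record K5Subdivision (H : Graph m) (c : Fin 5 → Fin m) : Set where
    field
      P      : Fin 5 → Fin 5 → List (Fin m)
      chain  : ∀ i j → i < j → Chain H (c i ∷ P i j ++ [ c j ])
      inV    : ∀ i j → i < j → All (_∈ₛ V H) (c i ∷ P i j ++ [ c j ])
      uniq   : ∀ i j → i < j → Unique (P i j)
      avoidC : ∀ i j → i < j → ∀ v → v ∈ P i j → ∀ k → v ≢ c k
      disj   : ∀ i j k l → i < j → k < l → (i ≢ k ⊎ j ≢ l) →
                 ∀ v → v ∈ P i j → ¬ (v ∈ P k l)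

-- The instance (G, s₁, s₂, t₁, t₂).  G' lives on Fin (suc n):
-- v* = zero, and a vertex x of G becomes suc x.

module _ {n : ℕ} where

  isTerm : (s₁ s₂ t₁ t₂ : Fin n) → Fin n → Bool
  isTerm s₁ s₂ t₁ t₂ x = (x == s₁) ∨ (x == s₂) ∨ (x == t₁) ∨ (x == t₂)

  cycEdge : (s₁ s₂ t₁ t₂ : Fin n) → Fin n → Fin n → Bool
  cycEdge s₁ s₂ t₁ t₂ a b =
    isPair s₁ s₂ a b ∨ isPair s₂ t₁ a b ∨ isPair t₁ t₂ a b ∨ isPair t₂ s₁ a b

  extV : Graph n → Fin (suc n) → Bool
  extV G zero = true
  extV G (suc x) = V G x

  extE : Graph n → (s₁ s₂ t₁ t₂ : Fin n) → Fin (suc n) → Fin (suc n) → Bool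
  extE G s₁ s₂ t₁ t₂ zero zero = false
  extE G s₁ s₂ t₁ t₂ zero (suc y) = isTerm s₁ s₂ t₁ t₂ y
  extE G s₁ s₂ t₁ t₂ (suc x) zero = isTerm s₁ s₂ t₁ t₂ x
  extE G s₁ s₂ t₁ t₂ (suc x) (suc y) = E G x y ∨ cycEdge s₁ s₂ t₁ t₂ x y

  extend : Graph n → (s₁ s₂ t₁ t₂ : Fin n) → Graph (suc n)
  extend G s₁ s₂ t₁ t₂ = mkGraph (extV G) (extE G s₁ s₂ t₁ t₂)

  roots : (s₁ s₂ t₁ t₂ : Fin n) → Fin 5 → Fin (suc n)
  roots s₁ s₂ t₁ t₂ zero = zero
  roots s₁ s₂ t₁ t₂ (suc zero) = suc s₁
  roots s₁ s₂ t₁ t₂ (suc (suc zero)) = suc s₂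
  roots s₁ s₂ t₁ t₂ (suc (suc (suc zero))) = suc t₁
  roots s₁ s₂ t₁ t₂ (suc (suc (suc (suc zero)))) = suc t₂

  rootSet : (s₁ s₂ t₁ t₂ : Fin n) → VSet (suc n)
  rootSet s₁ s₂ t₁ t₂ zero = true
  rootSet s₁ s₂ t₁ t₂ (suc x) = isTerm s₁ s₂ t₁ t₂ x

  record IsInstance (G : Graph n) (s₁ s₂ t₁ t₂ : Fin n) : Set where
    field
      simple : IsSimple G
      s₁∈ : s₁ ∈ₛ V G
      s₂∈ : s₂ ∈ₛ V G
      t₁∈ : t₁ ∈ₛ V G
      t₂∈ : t₂ ∈ₛ V G
      d₁ : s₁ ≢ s₂
      d₂ : s₁ ≢ t₁
      d₃ : s₁ ≢ t₂
      d₄ : s₂ ≢ t₁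
      d₅ : s₂ ≢ t₂
      d₆ : t₁ ≢ t₂

  IsRootGraph : Graph n → (s₁ s₂ t₁ t₂ : Fin n) → Graph (suc n) → Set
  IsRootGraph G s₁ s₂ t₁ t₂ T =
    ∃[ S ] IsBlockContaining G' C S × Reach C (induced G' S) T ×
      (∀ x y U → ¬ StepChoice C T x y U)
    where
      G' = extend G s₁ s₂ t₁ t₂
      C  = rootSet s₁ s₂ t₁ t₂

-- The root vertices already span K₅ minus the diagonals s₁t₁ and s₂t₂ in G' (v* sees the others
-- and s₁s₂t₁t₂ is a cycle), and the steps leading to the root graph T never delete a root vertex
-- or an edge of T between them. So in T, and likewise in its reduction F, a K₅-subdivision
-- centred at C amounts to disjoint s₁–t₁ and s₂–t₂ paths internally avoiding C.
-- A path of T between vertices of F is projected into F by replacing each excursion through a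
-- component U of T − V(F) by the edge of the triangle S(U) joining its ends; conversely an added
-- edge of F is routed through its component. Routed paths stay disjoint because two of them
-- through the same U would use two edges of the triangle S(U), which share a vertex.

module Submission where

open import Defs
open import Data.Nat using (ℕ; zero; suc; _≤_; z≤n; s≤s)
import Data.Nat.Properties as ℕ
open import Data.Fin using (Fin; zero; suc; _<_)
open import Data.Fin.Properties using (_≟_; any?; pigeonhole; suc-injective)
import Data.Fin.Subset as Subset
open import Data.Fin.Subset.Properties using (∣p∣≤n; p⊂q⇒∣p∣<∣q∣)
open import Data.Vec using (tabulate)
open import Data.Vec.Properties using (lookup∘tabulate; []=⇒lookup; lookup⇒[]=)
open import Data.Bool using (Bool; true; false; _∧_; _∨_; not)
import Data.Bool.Properties as Bool
open import Data.List using (List; []; _∷_; _++_; [_])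
open import Data.List.Relation.Unary.All as All using (All; []; _∷_)
open import Data.List.Relation.Unary.Any using (here; there) renaming (any? to anyₗ?)
open import Data.List.Relation.Unary.All.Properties using (¬Any⇒All¬; ++⁺; ++⁻ˡ)
open import Data.List.Relation.Unary.Unique.Propositional using (Unique)
open import Data.List.Relation.Unary.AllPairs using ([]; _∷_)
open import Data.List.Membership.Propositional using (_∈_)
open import Data.List.Membership.Propositional.Properties using (∈-++⁻; ∈-++⁺ˡ; ∈-++⁺ʳ)
open import Data.Product using (Σ; ∃; ∃-syntax; _×_; _,_; proj₁; proj₂; map₁)
open import Data.Sum using (_⊎_; inj₁; inj₂)
open import Data.Unit using (tt)
open import Data.Empty using (⊥; ⊥-elim)
open import Relation.Nullary using (¬_; yes; no)
open import Relation.Nullary.Decidable using (dec-true; _×-dec_)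
open import Relation.Binary.PropositionalEquality using (_≡_; _≢_; refl; sym; trans; cong; cong₂; subst)
open import Function.Bundles using (_⇔_; mk⇔; Equivalence)
open import Function.Base using (_∘_)

private variable
  m : ℕ

∧-trueˡ : ∀ {x y} → x ∧ y ≡ true → x ≡ true
∧-trueˡ {true} _ = refl

∧-trueʳ : ∀ {x y} → x ∧ y ≡ true → y ≡ true
∧-trueʳ {true} e = e

∧-true : ∀ {x y} → x ≡ true → y ≡ true → x ∧ y ≡ true
∧-true refl refl = refl

∨-trueˡ : ∀ {x} y → x ≡ true → x ∨ y ≡ true
∨-trueˡ y refl = refl

∨-trueʳ : ∀ x {y} → y ≡ true → x ∨ y ≡ true
∨-trueʳ true  _ = refl
∨-trueʳ false e = e

∨-true⁻ : ∀ {x y} → x ∨ y ≡ true → x ≡ true ⊎ y ≡ true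
∨-true⁻ {true}  _ = inj₁ refl
∨-true⁻ {false} e = inj₂ e

true≢false : ∀ {x} → x ≡ true → x ≢ false
true≢false refl ()

∖-intro : ∀ {S X : VSet m} {v} → v ∈ₛ S → X v ≡ false → v ∈ₛ (S ∖ X)
∖-intro p X≡false rewrite X≡false = ∧-true p refl

∖-elimˡ : ∀ {S X : VSet m} {v} → v ∈ₛ (S ∖ X) → v ∈ₛ S
∖-elimˡ {S = S} {X} {v} = ∧-trueˡ {S v}

∖-elimʳ : ∀ {S X : VSet m} {v} → v ∈ₛ (S ∖ X) → X v ≡ false
∖-elimʳ {S = S} {X} {v} p with X v | ∧-trueʳ {S v} p
... | false | _ = refl

==-refl : (a : Fin m) → (a == a) ≡ true
==-refl a = dec-true (a ≟ a) refl

==⇒≡ : {a b : Fin m} → (a == b) ≡ true → a ≡ b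
==⇒≡ {a = a} {b} e with a ≟ b
... | yes a≡b = a≡b

anyFin : ∀ {k} → (Fin k → Bool) → Bool
anyFin {zero}  f = false
anyFin {suc k} f = f zero ∨ anyFin (λ i → f (suc i))

anyFin-intro : ∀ {k} (f : Fin k → Bool) i → f i ≡ true → anyFin f ≡ true
anyFin-intro f zero    e = ∨-trueˡ _ e
anyFin-intro f (suc i) e = ∨-trueʳ (f zero) (anyFin-intro (λ j → f (suc j)) i e)

anyFin-elim : ∀ {k} (f : Fin k → Bool) → anyFin f ≡ true → ∃[ i ] f i ≡ true
anyFin-elim {suc k} f e with ∨-true⁻ {f zero} e
... | inj₁ p = zero , p
... | inj₂ p with anyFin-elim (λ j → f (suc j)) p
...   | i , q = suc i , q

anyFin-cong : ∀ {k} {f g : Fin k → Bool} → (∀ i → f i ≡ g i) → anyFin f ≡ anyFin g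
anyFin-cong {zero}  f≗g = refl
anyFin-cong {suc k} f≗g = cong₂ _∨_ (f≗g zero) (anyFin-cong (λ i → f≗g (suc i)))

_≐_ : VSet m → VSet m → Set
X ≐ Y = ∀ v → X v ≡ Y v

module Saturation (Φ : VSet m → VSet m) (Φ-inflationary : ∀ X → X ⊆ₛ Φ X)
                  (Φ-cong : ∀ {X Y} → X ≐ Y → Φ X ≐ Φ Y) (X₀ : VSet m) where

  iterate : ℕ → VSet m
  iterate zero    = X₀
  iterate (suc k) = Φ (iterate k)

  X₀⊆iterate : ∀ k → X₀ ⊆ₛ iterate k
  X₀⊆iterate zero    v v∈ = v∈
  X₀⊆iterate (suc k) v v∈ = Φ-inflationary _ v (X₀⊆iterate k v v∈)

  private
    Stable : ℕ → Set
    Stable k = iterate (suc k) ≐ iterate k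

    size : VSet m → ℕ
    size X = Subset.∣ tabulate X ∣

    ∈-tabulate : ∀ {X : VSet m} {v} → v ∈ₛ X → v Subset.∈ tabulate X
    ∈-tabulate {X = X} {v} p = lookup⇒[]= v _ (trans (lookup∘tabulate X v) p)

    ∈-tabulate⁻ : ∀ {X : VSet m} {v} → v Subset.∈ tabulate X → v ∈ₛ X
    ∈-tabulate⁻ {X = X} {v} p = trans (sym (lookup∘tabulate X v)) ([]=⇒lookup p)

    -- Until the iteration stabilises, every step adds a new vertex.
    progress : ∀ k → Stable k ⊎ k ≤ size (iterate k)
    progress zero = inj₂ z≤n
    progress (suc k) with progress k
    ... | inj₁ stable = inj₁ (Φ-cong stable)
    ... | inj₂ k≤size
      with any? (λ v → (iterate (suc k) v Bool.≟ true) ×-dec (iterate k v Bool.≟ false))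
    ...   | yes (v , new , old) = inj₂ (ℕ.≤-trans (s≤s k≤size) (p⊂q⇒∣p∣<∣q∣
              ( (λ p → ∈-tabulate (Φ-inflationary _ _ (∈-tabulate⁻ p)))
              , v , ∈-tabulate new , λ p → true≢false (∈-tabulate⁻ p) old)))
    ...   | no ¬new = inj₁ (Φ-cong stable)
      where
      stable : Stable k
      stable v with iterate k v in old
      ... | true  = Φ-inflationary _ v old
      ... | false with iterate (suc k) v in new
      ...   | true  = ⊥-elim (¬new (v , new , old))
      ...   | false = refl

  saturated : Φ (iterate (suc m)) ≐ iterate (suc m)
  saturated with progress (suc m)
  ... | inj₁ stable = stable
  ... | inj₂ m<size =
    ⊥-elim (ℕ.<-irrefl refl (ℕ.≤-trans m<size (∣p∣≤n (tabulate (iterate (suc m))))))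

Symmetric : Graph m → Set
Symmetric H = ∀ a b → E H a b ≡ E H b a

module _ {H : Graph m} where

  start∈ : ∀ {S a b} → Walk H S a b → a ∈ₛ S
  start∈ (here p)     = p
  start∈ (step p _ _) = p

  end∈ : ∀ {S a b} → Walk H S a b → b ∈ₛ S
  end∈ (here p)     = p
  end∈ (step _ _ w) = end∈ w

  snoc : ∀ {S a b c} → Walk H S a b → E H b c ≡ true → c ∈ₛ S → Walk H S a c
  snoc (here p)      e q = step p e (here q)
  snoc (step p e' w) e q = step p e' (snoc w e q)

  _++ʷ_ : ∀ {S a b c} → Walk H S a b → Walk H S b c → Walk H S a c
  here _     ++ʷ w' = w'
  step p e w ++ʷ w' = step p e (w ++ʷ w')

  reverse : Symmetric H → ∀ {S a b} → Walk H S a b → Walk H S b a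
  reverse symH (here p)     = here p
  reverse symH (step p e w) = snoc (reverse symH w) (trans (symH _ _) e) p

  component-⊆ : ∀ {S U₁ U₂ v} → IsComponent H S U₁ → IsComponent H S U₂ →
                v ∈ₛ U₁ → v ∈ₛ U₂ → U₁ ⊆ₛ U₂
  component-⊆ {U₂ = U₂} {v} (U₁⊆S , _ , conn₁ , _) (_ , _ , _ , closed₂) v∈U₁ v∈U₂ w w∈U₁ =
    go (conn₁ v w v∈U₁ w∈U₁) v∈U₂
    where
    go : ∀ {a b} → Walk H _ a b → a ∈ₛ U₂ → b ∈ₛ U₂
    go (here _)      a∈ = a∈
    go (step _ e w') a∈ = go w' (closed₂ _ _ a∈ (U₁⊆S _ (start∈ w')) e)

-- IsComponent asks for a decidable vertex set, so the component of x in H[S] is computed: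
-- saturate {x} under absorbing neighbours that lie in S.
module ComponentOf (H : Graph m) (symH : Symmetric H) (S : VSet m) {x : Fin m} (x∈S : x ∈ₛ S) where

  absorbNeighbours : VSet m → VSet m
  absorbNeighbours X v = X v ∨ (S v ∧ anyFin (λ w → X w ∧ E H w v))

  open Saturation absorbNeighbours (λ X v → ∨-trueˡ _)
                (λ X≐Y v → cong₂ (λ p q → p ∨ (S v ∧ q)) (X≐Y v)
                             (anyFin-cong (λ w → cong (_∧ E H w v) (X≐Y w))))
                (single x)

  U : VSet m
  U = iterate (suc m)

  closed : ∀ a b → a ∈ₛ U → b ∈ₛ S → E H a b ≡ true → b ∈ₛ U
  closed a b a∈U b∈S e = trans (sym (saturated b))
    (∨-trueʳ (U b) (∧-true b∈S (anyFin-intro (λ w → U w ∧ E H w b) a (∧-true a∈U e))))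

  reachable : ∀ k {v} → v ∈ₛ iterate k → Walk H S x v
  reachable zero    v∈ = subst (Walk H S x) (sym (==⇒≡ v∈)) (here x∈S)
  reachable (suc k) {v} v∈ with ∨-true⁻ {iterate k v} v∈
  ... | inj₁ old = reachable k old
  ... | inj₂ new with anyFin-elim (λ w → iterate k w ∧ E H w v) (∧-trueʳ {S v} new)
  ...   | w , p = snoc (reachable k (∧-trueˡ p)) (∧-trueʳ {iterate k w} p) (∧-trueˡ new)

  x∈U : x ∈ₛ U
  x∈U = X₀⊆iterate (suc m) x (==-refl x)

  restrict : ∀ {a b} → Walk H S a b → a ∈ₛ U → Walk H U a b
  restrict (here _)     a∈U = here a∈U
  restrict (step _ e w) a∈U = step a∈U e (restrict w (closed _ _ a∈U (start∈ w) e))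

  isComponent : IsComponent H S U
  isComponent = (λ v v∈U → end∈ (reachable (suc m) v∈U))
              , (x , x∈U)
              , (λ a b a∈U b∈U → reverse symH (restrict (reachable (suc m) a∈U) x∈U)
                                  ++ʷ restrict (reachable (suc m) b∈U) x∈U)
              , closed

componentContaining : ∀ {H : Graph m} → Symmetric H → ∀ {S x} → x ∈ₛ S →
  Σ (VSet m) λ U → IsComponent H S U × (∀ {y} → Walk H S x y → y ∈ₛ U)
componentContaining {H = H} symH {S} x∈S = U , isComponent , λ w → end∈ (restrict w x∈U)
  where open ComponentOf H symH S x∈S

_⊆ₗ_ : List (Fin m) → List (Fin m) → Set
xs ⊆ₗ ys = ∀ {v} → v ∈ xs → v ∈ ys

-- Steps H a b vs: a walk from a to b in H whose vertices after a are vs.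
data Steps (H : Graph m) : Fin m → Fin m → List (Fin m) → Set where
  nil  : ∀ {a} → Steps H a a []
  cons : ∀ {a x b vs} → E H a x ≡ true → Steps H x b vs → Steps H a b (x ∷ vs)

module _ {H : Graph m} where

  chain⇒steps : ∀ {a b} p → Chain H (a ∷ p ++ [ b ]) → Steps H a b (p ++ [ b ])
  chain⇒steps []      (e , _)  = cons e nil
  chain⇒steps (x ∷ p) (e , ch) = cons e (chain⇒steps p ch)

  steps⇒chain : ∀ {a b} p → Steps H a b (p ++ [ b ]) → Chain H (a ∷ p ++ [ b ])
  steps⇒chain []      (cons e nil) = e , tt
  steps⇒chain (x ∷ p) (cons e w)   = e , steps⇒chain p w

  _++ˢ_ : ∀ {a b c xs ys} → Steps H a b xs → Steps H b c ys → Steps H a c (xs ++ ys)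
  nil      ++ˢ w' = w'
  cons e w ++ˢ w' = cons e (w ++ˢ w')

  walk⇒steps : ∀ {S a b} → Walk H S a b → Σ (List (Fin m)) λ vs → Steps H a b vs × All (_∈ₛ S) vs
  walk⇒steps (here _) = [] , nil , []
  walk⇒steps (step _ e w) with walk⇒steps w
  ... | vs , w' , vs∈S = _ ∷ vs , cons e w' , start∈ w ∷ vs∈S

  private
    dropUntil : ∀ {x b} a ws → Steps H x b ws → Unique (x ∷ ws) → a ∈ (x ∷ ws) →
                Σ (List (Fin m)) λ ws' → Steps H a b ws' × Unique (a ∷ ws') × ws' ⊆ₗ ws
    dropUntil a ws w u (here refl) = ws , w , u , λ p → p
    dropUntil a (y ∷ ws) (cons e w) (_ ∷ u) (there p) with dropUntil a ws w u p
    ... | ws' , w' , u' , ws'⊆ws = ws' , w' , u' , λ q → there (ws'⊆ws q)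

  removeLoops : ∀ {a b vs} → Steps H a b vs →
                Σ (List (Fin m)) λ ws → Steps H a b ws × Unique (a ∷ ws) × ws ⊆ₗ vs
  removeLoops nil = [] , nil , [] ∷ [] , λ ()
  removeLoops {a} (cons {x = x} e w) with removeLoops w
  ... | ws , w' , u , ws⊆vs with anyₗ? (a ≟_) (x ∷ ws)
  ...   | yes a∈ = let (ws' , w'' , u' , ws'⊆ws) = dropUntil a ws w' u a∈ in
                   ws' , w'' , u' , λ q → there (ws⊆vs (ws'⊆ws q))
  ...   | no a∉ = x ∷ ws , cons e w' , ¬Any⇒All¬ (x ∷ ws) a∉ ∷ u ,
                  λ { (here q) → here q ; (there q) → there (ws⊆vs q) }

record Path (H : Graph m) (a b : Fin m) : Set where
  field
    interior : List (Fin m)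
    chain    : Chain H (a ∷ interior ++ [ b ])
    inV      : All (_∈ₛ V H) (a ∷ interior ++ [ b ])
    unique   : Unique interior
open Path using (interior)

∈-path⁻ : ∀ {a b v : Fin m} xs → v ∈ (a ∷ xs ++ [ b ]) → v ≡ a ⊎ v ∈ xs ⊎ v ≡ b
∈-path⁻ xs (here v≡a) = inj₁ v≡a
∈-path⁻ xs (there q) with ∈-++⁻ xs q
... | inj₁ v∈xs        = inj₂ (inj₁ v∈xs)
... | inj₂ (here v≡b) = inj₂ (inj₂ v≡b)

unique-++⁻ˡ : (xs : List (Fin m)) {ys : List (Fin m)} → Unique (xs ++ ys) → Unique xs
unique-++⁻ˡ []       _        = []
unique-++⁻ˡ (x ∷ xs) (x∉ ∷ u) = ++⁻ˡ xs x∉ ∷ unique-++⁻ˡ xs u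

unique-∉-last : (xs : List (Fin m)) {b : Fin m} → Unique (xs ++ [ b ]) → ∀ {v} → v ∈ xs → v ≢ b
unique-∉-last (x ∷ xs) (x∉ ∷ u) (here refl) = All.lookup x∉ (∈-++⁺ʳ xs (here refl))
unique-∉-last (x ∷ xs) (_ ∷ u)  (there q)   = unique-∉-last xs u q

module _ {H : Graph m} where

  private
    splitLast : ∀ {a b ws} → Steps H a b ws → ws ≡ [] ⊎ Σ (List (Fin m)) λ p → ws ≡ p ++ [ b ]
    splitLast nil          = inj₁ refl
    splitLast (cons e nil) = inj₂ ([] , refl)
    splitLast (cons {x = x} e w@(cons _ _)) with splitLast w
    ... | inj₂ (p , vs≡p++b) = inj₂ (x ∷ p , cong (x ∷_) vs≡p++b)

  steps⇒path : ∀ {a b ws} → a ≢ b → a ∈ₛ V H → b ∈ₛ V H → Steps H a b ws → All (_∈ₛ V H) ws →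
    Σ (Path H a b) λ P → ∀ {v} → v ∈ interior P → v ∈ ws × v ≢ a × v ≢ b
  steps⇒path {ws = ws} a≢b a∈V b∈V w ws∈V with removeLoops w
  ... | ws' , w' , a∉ ∷ u , ws'⊆ws with splitLast w'
  ...   | inj₁ refl with nil ← w' = ⊥-elim (a≢b refl)
  ...   | inj₂ (p , refl) =
    record { interior = p ; chain = steps⇒chain p w' ; unique = unique-++⁻ˡ p u
           ; inV = a∈V ∷ ++⁺ (All.tabulate (λ q → All.lookup ws∈V (in-ws q))) (b∈V ∷ []) }
    , λ q → in-ws q , (λ v≡a → All.lookup a∉ (∈-++⁺ˡ q) (sym v≡a)) , unique-∉-last p u q
    where
    in-ws : ∀ {v} → v ∈ p → v ∈ ws
    in-ws q = ws'⊆ws (∈-++⁺ˡ q)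

two-pairs-in-triangle-meet : ∀ {F : Graph m} {P : Fin m → Set} → IsTriangle F P →
  ∀ {p₁ q₁ p₂ q₂} → P p₁ → P q₁ → P p₂ → P q₂ → p₁ ≢ q₁ → p₂ ≢ q₂ →
  p₁ ≡ p₂ ⊎ p₁ ≡ q₂ ⊎ q₁ ≡ p₂ ⊎ q₁ ≡ q₂
two-pairs-in-triangle-meet {m = m} {P = P} (a , b , c , _ , _ , _ , P⇔ , _) {p₁} {q₁} {p₂} {q₂}
                           p₁∈ q₁∈ p₂∈ q₂∈ p₁≢q₁ p₂≢q₂ =
  meet (pigeonhole (ℕ.n<1+n 3) (λ i → proj₁ (index i)))
  where
  corner : Fin 3 → Fin m
  corner zero             = a
  corner (suc zero)       = b
  corner (suc (suc zero)) = c

  cornerOf : ∀ {v} → P v → Σ (Fin 3) λ i → v ≡ corner i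
  cornerOf v∈ with Equivalence.to (P⇔ _) v∈
  ... | inj₁ v≡a        = zero , v≡a
  ... | inj₂ (inj₁ v≡b) = suc zero , v≡b
  ... | inj₂ (inj₂ v≡c) = suc (suc zero) , v≡c

  vertex : Fin 4 → Fin m
  vertex zero                   = p₁
  vertex (suc zero)             = q₁
  vertex (suc (suc zero))       = p₂
  vertex (suc (suc (suc zero))) = q₂

  index : ∀ i → Σ (Fin 3) λ j → vertex i ≡ corner j
  index zero                   = cornerOf p₁∈
  index (suc zero)             = cornerOf q₁∈
  index (suc (suc zero))       = cornerOf p₂∈
  index (suc (suc (suc zero))) = cornerOf q₂∈

  vertex-≡ : ∀ {i j} → proj₁ (index i) ≡ proj₁ (index j) → vertex i ≡ vertex j
  vertex-≡ {i} {j} same = trans (proj₂ (index i)) (trans (cong corner same) (sym (proj₂ (index j))))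

  meet : (∃[ i ] ∃[ j ] i < j × proj₁ (index i) ≡ proj₁ (index j)) →
         p₁ ≡ p₂ ⊎ p₁ ≡ q₂ ⊎ q₁ ≡ p₂ ⊎ q₁ ≡ q₂
  meet (zero , suc zero , _ , same)                         = ⊥-elim (p₁≢q₁ (vertex-≡ same))
  meet (zero , suc (suc zero) , _ , same)                   = inj₁ (vertex-≡ same)
  meet (zero , suc (suc (suc zero)) , _ , same)             = inj₂ (inj₁ (vertex-≡ same))
  meet (suc zero , suc (suc zero) , _ , same)               = inj₂ (inj₂ (inj₁ (vertex-≡ same)))
  meet (suc zero , suc (suc (suc zero)) , _ , same)         = inj₂ (inj₂ (inj₂ (vertex-≡ same)))
  meet (suc (suc zero) , suc (suc (suc zero)) , _ , same)   = ⊥-elim (p₂≢q₂ (vertex-≡ same))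
  meet (_ , zero , () , _)
  meet (suc _ , suc zero , s≤s () , _)
  meet (suc (suc _) , suc (suc zero) , s≤s (s≤s ()) , _)
  meet (suc (suc (suc _)) , suc (suc (suc zero)) , s≤s (s≤s (s≤s ())) , _)

module Reduction (T F : Graph m) (symT : Symmetric T) {C : VSet m} (red : IsReduction C T F) where
  open IsReduction red

  Outside : VSet m
  Outside = V T ∖ V F

  outside : ∀ {v} → v ∈ₛ V T → V F v ≡ false → v ∈ₛ Outside
  outside = ∖-intro {S = V T} {X = V F}

  outside⇒∉F : ∀ {v} → v ∈ₛ Outside → V F v ≡ false
  outside⇒∉F = ∖-elimʳ {S = V T} {X = V F}

  real-edge : ∀ {a b} → a ∈ₛ V F → b ∈ₛ V F → E T a b ≡ true → E F a b ≡ true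
  real-edge a∈F b∈F e = Equivalence.from (edges _ _) (inj₁ (a∈F , b∈F , e))

  edge-endʳ : ∀ {a b} → E F a b ≡ true → b ∈ₛ V F
  edge-endʳ e with Equivalence.to (edges _ _) e
  ... | inj₁ (_ , b∈F , _)               = b∈F
  ... | inj₂ (_ , _ , _ , (b∈F , _) , _) = b∈F

  steps-in-F : ∀ {a b ws} → Steps F a b ws → All (_∈ₛ V F) ws
  steps-in-F nil        = []
  steps-in-F (cons e w) = edge-endʳ e ∷ steps-in-F w

  -- The two ends of an excursion of T through a component U of T − V(F) are adjacent in F:
  -- already in T, or else by the edge added for the triangle S(U).
  bypass : ∀ {a c x y} → a ∈ₛ V F → c ∈ₛ V F → a ≢ c → E T a x ≡ true → x ∈ₛ Outside →
           Walk T Outside x y → E T y c ≡ true → E F a c ≡ true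
  bypass {a} {c} {x} a∈F c∈F a≢c ax x∈ w yc with E T a c in ac
  ... | true  = real-edge a∈F c∈F ac
  ... | false with componentContaining symT {S = Outside} x∈
  ...   | U , U-comp , reach = Equivalence.from (edges a c)
          (inj₂ (U , U-comp , (a∈F , x , reach (here x∈) , trans (symT x a) ax)
                            , (c∈F , _ , reach w , yc) , a≢c , ac))

  project : ∀ {a b vs} → a ∈ₛ V F → b ∈ₛ V F → Steps T a b vs → All (_∈ₛ V T) vs →
            Σ (List (Fin m)) λ ws → Steps F a b ws × ws ⊆ₗ vs
  projectExcursion : ∀ {a b x y vs} → a ∈ₛ V F → b ∈ₛ V F → E T a x ≡ true → x ∈ₛ Outside →
            Walk T Outside x y → Steps T y b vs → All (_∈ₛ V T) vs →
            Σ (List (Fin m)) λ ws → Steps F a b ws × ws ⊆ₗ vs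

  project a∈F b∈F nil _ = [] , nil , λ ()
  project a∈F b∈F (cons {x = x} e w) (x∈T ∷ vs∈T) with V F x in x∈F?
  ... | true with project x∈F? b∈F w vs∈T
  ...   | ws , w' , ws⊆ = x ∷ ws , cons (real-edge a∈F x∈F? e) w'
                        , λ { (here q) → here q ; (there q) → there (ws⊆ q) }
  project a∈F b∈F (cons {x = x} e w) (x∈T ∷ vs∈T) | false
    with projectExcursion a∈F b∈F e (outside x∈T x∈F?) (here (outside x∈T x∈F?)) w vs∈T
  ... | ws , w' , ws⊆ = ws , w' , λ q → there (ws⊆ q)

  projectExcursion a∈F b∈F ax x∈ excursion nil _ =
    ⊥-elim (true≢false b∈F (outside⇒∉F (end∈ excursion)))
  projectExcursion a∈F b∈F ax x∈ excursion (cons {x = z} e w) (z∈T ∷ vs∈T) with V F z in z∈F?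
  ... | false with projectExcursion a∈F b∈F ax x∈ (snoc excursion e (outside z∈T z∈F?)) w vs∈T
  ...   | ws , w' , ws⊆ = ws , w' , λ q → there (ws⊆ q)
  projectExcursion {a} a∈F b∈F ax x∈ excursion (cons {x = z} e w) (z∈T ∷ vs∈T) | true with a ≟ z
  ...   | yes refl with project a∈F b∈F w vs∈T
  ...     | ws , w' , ws⊆ = ws , w' , λ q → there (ws⊆ q)
  projectExcursion {a} a∈F b∈F ax x∈ excursion (cons {x = z} e w) (z∈T ∷ vs∈T) | true | no a≢z
    with project z∈F? b∈F w vs∈T
  ...     | ws , w' , ws⊆ = z ∷ ws , cons (bypass a∈F z∈F? a≢z ax x∈ excursion e) w'
                          , λ { (here q) → here q ; (there q) → there (ws⊆ q) }

  path-T⇒F : ∀ {a b} → a ∈ₛ V F → b ∈ₛ V F → a ≢ b → (P : Path T a b) →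
             Σ (Path F a b) λ Q → interior Q ⊆ₗ interior P
  path-T⇒F {a} {b} a∈F b∈F a≢b P
    with project a∈F b∈F (chain⇒steps (interior P) (Path.chain P)) (All.tail (Path.inV P))
  ... | ws , w , ws⊆ with steps⇒path a≢b a∈F b∈F w (steps-in-F w)
  ...   | Q , Q⊆ = Q , λ q → let (q∈ws , _ , v≢b) = Q⊆ q in interior-or-end (ws⊆ q∈ws) v≢b
    where
    interior-or-end : ∀ {v} → v ∈ interior P ++ [ b ] → v ≢ b → v ∈ interior P
    interior-or-end q v≢b with ∈-++⁻ (interior P) q
    ... | inj₁ q'        = q'
    ... | inj₂ (here v≡b) = ⊥-elim (v≢b v≡b)

  -- Vertices of T that a walk of F along L may need: L itself, and the components of T − V(F)
  -- behind the added edges between vertices of L.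
  data InExpansion (L : List (Fin m)) (v : Fin m) : Set where
    onList : v ∈ L → InExpansion L v
    behind : ∀ {U p q} → IsComponent T Outside U → v ∈ₛ U → p ∈ L → q ∈ L → p ≢ q →
             Attach T F U p → Attach T F U q → InExpansion L v

  expansion-mono : ∀ {L L' v} → L ⊆ₗ L' → InExpansion L v → InExpansion L' v
  expansion-mono L⊆L' (onList v∈L)                 = onList (L⊆L' v∈L)
  expansion-mono L⊆L' (behind U v∈U p∈ q∈ p≢q ap aq) = behind U v∈U (L⊆L' p∈) (L⊆L' q∈) p≢q ap aq

  expansion-in-T : ∀ {L v} → All (_∈ₛ V F) L → InExpansion L v → v ∈ₛ V T
  expansion-in-T L⊆F (onList v∈L)            = F⊆H _ (All.lookup L⊆F v∈L)
  expansion-in-T L⊆F (behind U v∈U _ _ _ _ _) = ∖-elimˡ {S = V T} {X = V F} (proj₁ U _ v∈U)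

  expand : ∀ {a b vs} → Steps F a b vs →
           Σ (List (Fin m)) λ ws → Steps T a b ws × (∀ {v} → v ∈ ws → InExpansion (a ∷ vs) v)
  expand nil = [] , nil , λ ()
  expand {a} (cons {x = x} {vs = rest} e w) with expand w | Equivalence.to (edges a x) e
  ... | ws , w' , ws⊆ | inj₁ (_ , _ , ax) =
    x ∷ ws , cons ax w' ,
    λ { (here refl) → onList (there (here refl)) ; (there q) → expansion-mono there (ws⊆ q) }
  ... | ws , w' , ws⊆ | inj₂ (U , U-comp@(_ , _ , U-connected , _) ,
                              a-att@(_ , u , u∈U , ua) , x-att@(_ , u' , u'∈U , u'x) , a≢x , _)
    with walk⇒steps (U-connected u u' u∈U u'∈U)
  ...   | ls , through , ls⊆U =
    u ∷ (ls ++ x ∷ ws) , cons (trans (symT a u) ua) (through ++ˢ cons u'x w') ,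
    λ { (here refl) → inU u∈U ; (there q) → later (∈-++⁻ ls q) }
    where
    inU : ∀ {v} → v ∈ₛ U → InExpansion (a ∷ x ∷ rest) v
    inU v∈U = behind U-comp v∈U (here refl) (there (here refl)) a≢x a-att x-att
    later : ∀ {v} → v ∈ ls ⊎ v ∈ x ∷ ws → InExpansion (a ∷ x ∷ rest) v
    later (inj₁ q)           = inU (All.lookup ls⊆U q)
    later (inj₂ (here refl)) = onList (there (here refl))
    later (inj₂ (there q))   = expansion-mono there (ws⊆ q)

  path-F⇒T : ∀ {a b} → a ≢ b → (P : Path F a b) →
    Σ (Path T a b) λ Q →
      ∀ {v} → v ∈ interior Q → InExpansion (a ∷ interior P ++ [ b ]) v × v ≢ a × v ≢ b
  path-F⇒T {a} {b} a≢b P with expand (chain⇒steps (interior P) (Path.chain P))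
  ... | ws , w , ws⊆
    with steps⇒path a≢b (in-T (here refl)) (in-T (there (∈-++⁺ʳ (interior P) (here refl))))
                    w (All.tabulate λ q → expansion-in-T (Path.inV P) (ws⊆ q))
    where
    in-T : ∀ {v} → v ∈ a ∷ interior P ++ [ b ] → v ∈ₛ V T
    in-T q = F⊆H _ (All.lookup (Path.inV P) q)
  ...   | Q , Q⊆ = Q , λ q → map₁ ws⊆ (Q⊆ q)

  expansions-disjoint : ∀ {L₁ L₂} → (∀ {v} → v ∈ L₁ → v ∈ L₂ → ⊥) →
    All (_∈ₛ V F) L₁ → All (_∈ₛ V F) L₂ → ∀ {v} → InExpansion L₁ v → InExpansion L₂ v → ⊥
  expansions-disjoint L₁#L₂ _ _ (onList v∈L₁) (onList v∈L₂) = L₁#L₂ v∈L₁ v∈L₂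
  expansions-disjoint L₁#L₂ L₁⊆F _ (onList v∈L₁) (behind U v∈U _ _ _ _ _) =
    true≢false (All.lookup L₁⊆F v∈L₁) (outside⇒∉F (proj₁ U _ v∈U))
  expansions-disjoint L₁#L₂ _ L₂⊆F (behind U v∈U _ _ _ _ _) (onList v∈L₂) =
    true≢false (All.lookup L₂⊆F v∈L₂) (outside⇒∉F (proj₁ U _ v∈U))
  expansions-disjoint L₁#L₂ _ _
    (behind {U₁} U₁-comp v∈U₁ p₁∈ q₁∈ p₁≢q₁ p₁-att q₁-att)
    (behind {U₂} U₂-comp v∈U₂ p₂∈ q₂∈ p₂≢q₂ p₂-att q₂-att)
    with two-pairs-in-triangle-meet {F = F} {P = Attach T F U₂} (triangle U₂ U₂-comp)
           (widen p₁-att) (widen q₁-att) p₂-att q₂-att p₁≢q₁ p₂≢q₂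
    where
    widen : ∀ {p} → Attach T F U₁ p → Attach T F U₂ p
    widen (p∈F , u , u∈U₁ , up) = p∈F , u , component-⊆ U₁-comp U₂-comp v∈U₁ v∈U₂ u u∈U₁ , up
  ... | inj₁ refl               = L₁#L₂ p₁∈ p₂∈
  ... | inj₂ (inj₁ refl)        = L₁#L₂ p₁∈ q₂∈
  ... | inj₂ (inj₂ (inj₁ refl)) = L₁#L₂ q₁∈ p₂∈
  ... | inj₂ (inj₂ (inj₂ refl)) = L₁#L₂ q₁∈ q₂∈

pattern i0 = zero
pattern i1 = suc i0
pattern i2 = suc i1
pattern i3 = suc i2
pattern i4 = suc i3

data Direct : Fin 5 → Fin 5 → Set where
  d01 : Direct i0 i1
  d02 : Direct i0 i2
  d03 : Direct i0 i3
  d04 : Direct i0 i4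
  d12 : Direct i1 i2
  d14 : Direct i1 i4
  d23 : Direct i2 i3
  d34 : Direct i3 i4

data Branch : Fin 5 → Fin 5 → Set where
  direct : ∀ {i j} → Direct i j → Branch i j
  diag₁₃ : Branch i1 i3
  diag₂₄ : Branch i2 i4

branch : ∀ i j → i < j → Branch i j
branch i0 i1 _ = direct d01
branch i0 i2 _ = direct d02
branch i0 i3 _ = direct d03
branch i0 i4 _ = direct d04
branch i1 i2 _ = direct d12
branch i1 i3 _ = diag₁₃
branch i1 i4 _ = direct d14
branch i2 i3 _ = direct d23
branch i2 i4 _ = diag₂₄
branch i3 i4 _ = direct d34
branch _ i0 ()
branch (suc _) i1 (s≤s ())
branch (suc (suc _)) i2 (s≤s (s≤s ()))
branch (suc (suc (suc _))) i3 (s≤s (s≤s (s≤s ())))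
branch (suc (suc (suc (suc _)))) i4 (s≤s (s≤s (s≤s (s≤s ()))))

record DiagonalPaths (H : Graph m) (c : Fin 5 → Fin m) : Set where
  field
    path₁₃   : Path H (c i1) (c i3)
    path₂₄   : Path H (c i2) (c i4)
    avoid₁₃  : ∀ {v} → v ∈ interior path₁₃ → ∀ k → v ≢ c k
    avoid₂₄  : ∀ {v} → v ∈ interior path₂₄ → ∀ k → v ≢ c k
    disjoint : ∀ {v} → v ∈ interior path₁₃ → v ∈ interior path₂₄ → ⊥

module _ {H : Graph m} {c : Fin 5 → Fin m} where

  k5⇒diagonals : K5Subdivision H c → DiagonalPaths H c
  k5⇒diagonals k5 = record
    { path₁₃   = branchPath i1 i3 1<3
    ; path₂₄   = branchPath i2 i4 2<4
    ; avoid₁₃  = λ q → avoidC i1 i3 1<3 _ q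
    ; avoid₂₄  = λ q → avoidC i2 i4 2<4 _ q
    ; disjoint = λ q r → disj i1 i3 i2 i4 1<3 2<4 (inj₁ λ ()) _ q r
    }
    where
    open K5Subdivision k5

    branchPath : ∀ i j → i < j → Path H (c i) (c j)
    branchPath i j i<j = record
      { interior = P i j ; chain = chain i j i<j ; inV = inV i j i<j ; unique = uniq i j i<j }

    1<3 : _<_ {5} {5} i1 i3
    1<3 = s≤s (s≤s z≤n)
    2<4 : _<_ {5} {5} i2 i4
    2<4 = s≤s (s≤s (s≤s z≤n))

  diagonals⇒k5 : (∀ k → c k ∈ₛ V H) → (∀ {i j} → Direct i j → E H (c i) (c j) ≡ true) →
                 DiagonalPaths H c → K5Subdivision H c
  diagonals⇒k5 c∈V adjacent diagonals = record
    { P = P ; chain = chain ; inV = inV ; uniq = uniq ; avoidC = avoidC ; disj = disj }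
    where
    open DiagonalPaths diagonals

    P : Fin 5 → Fin 5 → List (Fin m)
    P i1 i3 = interior path₁₃
    P i2 i4 = interior path₂₄
    P _  _  = []

    direct-empty : ∀ {i j} → Direct i j → P i j ≡ []
    direct-empty d01 = refl
    direct-empty d02 = refl
    direct-empty d03 = refl
    direct-empty d04 = refl
    direct-empty d12 = refl
    direct-empty d14 = refl
    direct-empty d23 = refl
    direct-empty d34 = refl

    chain : ∀ i j → i < j → Chain H (c i ∷ P i j ++ [ c j ])
    chain i j i<j with branch i j i<j
    ... | direct d rewrite direct-empty d = adjacent d , tt
    ... | diag₁₃ = Path.chain path₁₃
    ... | diag₂₄ = Path.chain path₂₄

    inV : ∀ i j → i < j → All (_∈ₛ V H) (c i ∷ P i j ++ [ c j ])
    inV i j i<j with branch i j i<j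
    ... | direct d rewrite direct-empty d = c∈V i ∷ c∈V j ∷ []
    ... | diag₁₃ = Path.inV path₁₃
    ... | diag₂₄ = Path.inV path₂₄

    uniq : ∀ i j → i < j → Unique (P i j)
    uniq i j i<j with branch i j i<j
    ... | direct d rewrite direct-empty d = []
    ... | diag₁₃ = Path.unique path₁₃
    ... | diag₂₄ = Path.unique path₂₄

    avoidC : ∀ i j → i < j → ∀ v → v ∈ P i j → ∀ k → v ≢ c k
    avoidC i j i<j v with branch i j i<j
    ... | direct d rewrite direct-empty d = λ ()
    ... | diag₁₃ = avoid₁₃
    ... | diag₂₄ = avoid₂₄

    same-branch : ∀ {i j : Fin 5} → i ≢ i ⊎ j ≢ j → ⊥
    same-branch (inj₁ i≢i) = i≢i refl
    same-branch (inj₂ j≢j) = j≢j refl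

    disj : ∀ i j k l → i < j → k < l → (i ≢ k ⊎ j ≢ l) → ∀ v → v ∈ P i j → ¬ (v ∈ P k l)
    disj i j k l i<j k<l different v with branch i j i<j | branch k l k<l
    ... | direct d | _ rewrite direct-empty d = λ ()
    ... | diag₁₃ | direct d rewrite direct-empty d = λ _ ()
    ... | diag₂₄ | direct d rewrite direct-empty d = λ _ ()
    ... | diag₁₃ | diag₂₄ = disjoint
    ... | diag₂₄ | diag₁₃ = λ q r → disjoint r q
    ... | diag₁₃ | diag₁₃ = ⊥-elim (same-branch different)
    ... | diag₂₄ | diag₂₄ = ⊥-elim (same-branch different)

module DiagonalTransfer (T F : Graph m) (symT : Symmetric T) {C : VSet m} (red : IsReduction C T F)
                        (c : Fin 5 → Fin m) (c-injective : ∀ {i j} → c i ≡ c j → i ≡ j)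
                        (c∈F : ∀ k → c k ∈ₛ V F) where
  open Reduction T F symT red

  private
    c≢ : ∀ {i j} → i ≢ j → c i ≢ c j
    c≢ i≢j e = i≢j (c-injective e)

  module _ (D : DiagonalPaths T c) where
    open DiagonalPaths D

    diagonals-T⇒F : DiagonalPaths F c
    diagonals-T⇒F with path-T⇒F (c∈F i1) (c∈F i3) (c≢ λ ()) path₁₃
                     | path-T⇒F (c∈F i2) (c∈F i4) (c≢ λ ()) path₂₄
    ... | Q₁₃ , Q₁₃⊆ | Q₂₄ , Q₂₄⊆ = record
      { path₁₃ = Q₁₃ ; path₂₄ = Q₂₄
      ; avoid₁₃ = λ q → avoid₁₃ (Q₁₃⊆ q)
      ; avoid₂₄ = λ q → avoid₂₄ (Q₂₄⊆ q)
      ; disjoint = λ q r → disjoint (Q₁₃⊆ q) (Q₂₄⊆ r) }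

  private
    avoid-expansion : ∀ {i j} (P : Path F (c i) (c j)) → (∀ {v} → v ∈ interior P → ∀ k → v ≢ c k) →
      ∀ {v} → InExpansion (c i ∷ interior P ++ [ c j ]) v × v ≢ c i × v ≢ c j → ∀ k → v ≢ c k
    avoid-expansion P avoid (onList q , v≢ci , v≢cj) k with ∈-path⁻ (interior P) q
    ... | inj₁ v≡ci        = ⊥-elim (v≢ci v≡ci)
    ... | inj₂ (inj₁ q')   = avoid q' k
    ... | inj₂ (inj₂ v≡cj) = ⊥-elim (v≢cj v≡cj)
    avoid-expansion P avoid (behind U v∈U _ _ _ _ _ , _) k refl =
      true≢false (c∈F k) (outside⇒∉F (proj₁ U _ v∈U))

  module _ (D : DiagonalPaths F c) where
    open DiagonalPaths D

    private
      diagonal-ends-disjoint : ∀ {v} → v ∈ c i1 ∷ interior path₁₃ ++ [ c i3 ] →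
                               v ∈ c i2 ∷ interior path₂₄ ++ [ c i4 ] → ⊥
      diagonal-ends-disjoint q r with ∈-path⁻ (interior path₁₃) q | ∈-path⁻ (interior path₂₄) r
      ... | inj₁ refl        | inj₁ e           = c≢ (λ ()) e
      ... | inj₁ refl        | inj₂ (inj₁ r')   = avoid₂₄ r' i1 refl
      ... | inj₁ refl        | inj₂ (inj₂ e)    = c≢ (λ ()) e
      ... | inj₂ (inj₁ q')   | inj₁ refl        = avoid₁₃ q' i2 refl
      ... | inj₂ (inj₁ q')   | inj₂ (inj₁ r')   = disjoint q' r'
      ... | inj₂ (inj₁ q')   | inj₂ (inj₂ refl) = avoid₁₃ q' i4 refl
      ... | inj₂ (inj₂ refl) | inj₁ e           = c≢ (λ ()) e
      ... | inj₂ (inj₂ refl) | inj₂ (inj₁ r')   = avoid₂₄ r' i3 refl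
      ... | inj₂ (inj₂ refl) | inj₂ (inj₂ e)    = c≢ (λ ()) e

    diagonals-F⇒T : DiagonalPaths T c
    diagonals-F⇒T with path-F⇒T (c≢ λ ()) path₁₃ | path-F⇒T (c≢ λ ()) path₂₄
    ... | Q₁₃ , Q₁₃⊆ | Q₂₄ , Q₂₄⊆ = record
      { path₁₃ = Q₁₃ ; path₂₄ = Q₂₄
      ; avoid₁₃ = λ q → avoid-expansion path₁₃ avoid₁₃ (Q₁₃⊆ q)
      ; avoid₂₄ = λ q → avoid-expansion path₂₄ avoid₂₄ (Q₂₄⊆ q)
      ; disjoint = λ q r → expansions-disjoint diagonal-ends-disjoint (Path.inV path₁₃) (Path.inV path₂₄)
                             (proj₁ (Q₁₃⊆ q)) (proj₁ (Q₂₄⊆ r)) }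

isPair-sym : ∀ (p q a b : Fin m) → isPair p q a b ≡ isPair p q b a
isPair-sym p q a b = trans (cong₂ _∨_ (Bool.∧-comm (a == p) (b == q)) (Bool.∧-comm (a == q) (b == p)))
                           (Bool.∨-comm ((b == q) ∧ (a == p)) ((b == p) ∧ (a == q)))

-- H contains the frame on c: the complete graph on c minus the diagonals c₁c₃ and c₂c₄.
record Framed (H : Graph m) (c : Fin 5 → Fin m) : Set where
  field
    symmetric : Symmetric H
    roots∈V   : ∀ k → c k ∈ₛ V H
    adjacent  : ∀ {i j} → Direct i j → E H (c i) (c j) ≡ true

module _ {c : Fin 5 → Fin m} where

  ≅-framed : ∀ {H H'} → H ≅ H' → Framed H c → Framed H' c
  ≅-framed (V≗ , E≗) fr = record
    { symmetric = λ a b → trans (sym (E≗ a b)) (trans (symmetric a b) (E≗ b a))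
    ; roots∈V   = λ k → trans (sym (V≗ (c k))) (roots∈V k)
    ; adjacent  = λ d → trans (sym (E≗ _ _)) (adjacent d) }
    where open Framed fr

  induced-framed : ∀ {H S} → Framed H c → (∀ k → c k ∈ₛ S) → Framed (induced H S) c
  induced-framed {S = S} fr c∈S = record
    { symmetric = λ a b → cong₂ _∧_ (symmetric a b) (Bool.∧-comm (S a) (S b))
    ; roots∈V   = c∈S
    ; adjacent  = λ {i} {j} d → ∧-true (adjacent d) (∧-true (c∈S i) (c∈S j)) }
    where open Framed fr

  step-framed : ∀ {C H H'} → (∀ k → c k ∈ₛ C) → Step C H H' → Framed H c → Framed H' c
  step-framed c∈C (x , y , U , choice , V≗ , E≗) fr = record
    { symmetric = λ a b → trans (E≗ a b) (trans
        (cong₂ _∨_ (cong₂ _∧_ (symmetric a b) (Bool.∧-comm (not (U a)) (not (U b)))) (isPair-sym x y a b))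
        (sym (E≗ b a)))
    ; roots∈V   = λ k → trans (V≗ (c k)) (∧-true (roots∈V k) (kept k))
    ; adjacent  = λ {i} {j} d → trans (E≗ (c i) (c j))
                    (∨-trueˡ _ (∧-true (adjacent d) (∧-true (kept i) (kept j)))) }
    where
    open Framed fr
    kept : ∀ k → not (U (c k)) ≡ true
    kept k rewrite StepChoice.avoid choice (c k) (c∈C k) = refl

  reach-framed : ∀ {C H H'} → (∀ k → c k ∈ₛ C) → Reach C H H' → Framed H c → Framed H' c
  reach-framed c∈C (done H≅H')  = ≅-framed H≅H'
  reach-framed c∈C (more st rs) = reach-framed c∈C rs ∘ step-framed c∈C st

k5Subdivision-reduction-⇔ : ∀ {T F : Graph m} {C c} → Framed T c → (∀ {i j} → c i ≡ c j → i ≡ j) →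
                 (∀ k → c k ∈ₛ C) → IsReduction C T F → K5Subdivision T c ⇔ K5Subdivision F c
k5Subdivision-reduction-⇔ {T = T} {F} {c = c} frame c-injective c∈C red = mk⇔
  (λ k5 → diagonals⇒k5 c∈F adjacentF (diagonals-T⇒F (k5⇒diagonals k5)))
  (λ k5 → diagonals⇒k5 roots∈V adjacent (diagonals-F⇒T (k5⇒diagonals k5)))
  where
  open Framed frame
  open IsReduction red using (C⊆F)

  c∈F : ∀ k → c k ∈ₛ V F
  c∈F k = C⊆F _ (c∈C k)

  open Reduction T F symmetric red using (real-edge)
  open DiagonalTransfer T F symmetric red c c-injective c∈F

  adjacentF : ∀ {i j} → Direct i j → E F (c i) (c j) ≡ true
  adjacentF d = real-edge (c∈F _) (c∈F _) (adjacent d)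

module Instance {n : ℕ} {G : Graph n} {s₁ s₂ t₁ t₂ : Fin n} (inst : IsInstance G s₁ s₂ t₁ t₂) where
  open IsInstance inst

  private
    G' : Graph (suc n)
    G' = extend G s₁ s₂ t₁ t₂

    C : VSet (suc n)
    C = rootSet s₁ s₂ t₁ t₂

    c : Fin 5 → Fin (suc n)
    c = roots s₁ s₂ t₁ t₂

    isPair-refl : ∀ (p q : Fin n) → isPair p q p q ≡ true
    isPair-refl p q = ∨-trueˡ _ (∧-true (==-refl p) (==-refl q))

    isPair-flip : ∀ (p q : Fin n) → isPair p q q p ≡ true
    isPair-flip p q = ∨-trueʳ ((q == p) ∧ (p == q)) (∧-true (==-refl q) (==-refl p))

  roots∈C : ∀ k → c k ∈ₛ C
  roots∈C i0 = refl
  roots∈C i1 = ∨-trueˡ _ (==-refl s₁)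
  roots∈C i2 = ∨-trueʳ (s₂ == s₁) (∨-trueˡ _ (==-refl s₂))
  roots∈C i3 = ∨-trueʳ (t₁ == s₁) (∨-trueʳ (t₁ == s₂) (∨-trueˡ _ (==-refl t₁)))
  roots∈C i4 = ∨-trueʳ (t₂ == s₁) (∨-trueʳ (t₂ == s₂) (∨-trueʳ (t₂ == t₁) (==-refl t₂)))

  roots-injective : ∀ {i j} → c i ≡ c j → i ≡ j
  roots-injective {i0} {i0} _ = refl
  roots-injective {i1} {i1} _ = refl
  roots-injective {i2} {i2} _ = refl
  roots-injective {i3} {i3} _ = refl
  roots-injective {i4} {i4} _ = refl
  roots-injective {i1} {i2} e = ⊥-elim (d₁ (suc-injective e))
  roots-injective {i1} {i3} e = ⊥-elim (d₂ (suc-injective e))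
  roots-injective {i1} {i4} e = ⊥-elim (d₃ (suc-injective e))
  roots-injective {i2} {i3} e = ⊥-elim (d₄ (suc-injective e))
  roots-injective {i2} {i4} e = ⊥-elim (d₅ (suc-injective e))
  roots-injective {i3} {i4} e = ⊥-elim (d₆ (suc-injective e))
  roots-injective {i2} {i1} e = ⊥-elim (d₁ (sym (suc-injective e)))
  roots-injective {i3} {i1} e = ⊥-elim (d₂ (sym (suc-injective e)))
  roots-injective {i4} {i1} e = ⊥-elim (d₃ (sym (suc-injective e)))
  roots-injective {i3} {i2} e = ⊥-elim (d₄ (sym (suc-injective e)))
  roots-injective {i4} {i2} e = ⊥-elim (d₅ (sym (suc-injective e)))
  roots-injective {i4} {i3} e = ⊥-elim (d₆ (sym (suc-injective e)))
  roots-injective {i0} {i1} ()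
  roots-injective {i0} {i2} ()
  roots-injective {i0} {i3} ()
  roots-injective {i0} {i4} ()
  roots-injective {i1} {i0} ()
  roots-injective {i2} {i0} ()
  roots-injective {i3} {i0} ()
  roots-injective {i4} {i0} ()

  extend-framed : Framed G' c
  extend-framed = record { symmetric = symmetric ; roots∈V = roots∈V ; adjacent = adjacent }
    where
    cycEdge-sym : ∀ a b → cycEdge s₁ s₂ t₁ t₂ a b ≡ cycEdge s₁ s₂ t₁ t₂ b a
    cycEdge-sym a b rewrite isPair-sym s₁ s₂ a b | isPair-sym s₂ t₁ a b
                          | isPair-sym t₁ t₂ a b | isPair-sym t₂ s₁ a b = refl

    symmetric : Symmetric G'
    symmetric zero    zero    = refl
    symmetric zero    (suc y) = refl
    symmetric (suc x) zero    = refl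
    symmetric (suc x) (suc y) = cong₂ _∨_ (IsSimple.sym simple x y) (cycEdge-sym x y)

    roots∈V : ∀ k → c k ∈ₛ V G'
    roots∈V i0 = refl
    roots∈V i1 = s₁∈
    roots∈V i2 = s₂∈
    roots∈V i3 = t₁∈
    roots∈V i4 = t₂∈

    adjacent : ∀ {i j} → Direct i j → E G' (c i) (c j) ≡ true
    adjacent d01 = roots∈C i1
    adjacent d02 = roots∈C i2
    adjacent d03 = roots∈C i3
    adjacent d04 = roots∈C i4
    adjacent d12 = ∨-trueʳ (E G s₁ s₂) (∨-trueˡ _ (isPair-refl s₁ s₂))
    adjacent d23 = ∨-trueʳ (E G s₂ t₁) (∨-trueʳ (isPair s₁ s₂ s₂ t₁) (∨-trueˡ _ (isPair-refl s₂ t₁)))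
    adjacent d34 = ∨-trueʳ (E G t₁ t₂) (∨-trueʳ (isPair s₁ s₂ t₁ t₂) (∨-trueʳ (isPair s₂ t₁ t₁ t₂)
                     (∨-trueˡ _ (isPair-refl t₁ t₂))))
    adjacent d14 = ∨-trueʳ (E G s₁ t₂) (∨-trueʳ (isPair s₁ s₂ s₁ t₂) (∨-trueʳ (isPair s₂ t₁ s₁ t₂)
                     (∨-trueʳ (isPair t₁ t₂ s₁ t₂) (isPair-flip t₂ s₁))))

  rootGraph-framed : ∀ {T} → IsRootGraph G s₁ s₂ t₁ t₂ T → Framed T c
  rootGraph-framed (S , (_ , C⊆S , _) , reach , _) =
    reach-framed roots∈C reach (induced-framed extend-framed (λ k → C⊆S _ (roots∈C k)))

mainTheorem4 : ∀ {n : ℕ} (G : Graph n) (s₁ s₂ t₁ t₂ : Fin n) →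
    IsInstance G s₁ s₂ t₁ t₂ →
    (T F : Graph (suc n)) →
    IsRootGraph G s₁ s₂ t₁ t₂ T →
    IsReduction (rootSet s₁ s₂ t₁ t₂) T F →
    K5Subdivision T (roots s₁ s₂ t₁ t₂) ⇔ K5Subdivision F (roots s₁ s₂ t₁ t₂)
mainTheorem4 G s₁ s₂ t₁ t₂ inst T F rootGraph red =
  k5Subdivision-reduction-⇔ (rootGraph-framed rootGraph) roots-injective roots∈C red
  where open Instance inst
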